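{- For any finite, simple, connected, undirected graph $G$ and any integer $k\geq 1$, $\mathrm{idct}(G,k)<\infty$.
   Context: Invisible drunk robber game on $G=(V,E)$ with $k$ cops: the cops choose initial positions $x\in V^k$, then the robber's initial vertex is chosen uniformly at random from $V$; in each round first each cop moves along an edge or stays, then the robber moves to a uniformly random neighbour of his current vertex (open neighbourhood), independently of the cops. The robber is invisible: the cops do not know his position until capture, so their (possibly randomized) strategy cannot depend on the robber's positions. The capture time is the first time a cop and the robber occupy the same vertex. $\mathrm{idct}_x(G,k)$ is the smallest expected capture time achievable by the cops from initial positions $x$, and $\mathrm{idct}(G,k)=\min_{x\in V^k}\mathrm{idct}_x(G,k)$. -}

module Defs where

open import Data.Nat using (ℕ; zero; suc)
open import Data.Fin using (Fin; _≟_)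
open import Data.Bool using (Bool; true; false; if_then_else_; not; _∧_)
open import Data.List using (List; []; _∷_; foldr; filter; length; allFin)
open import Data.Bool.ListAction using (any)
open import Data.Integer using (+_)
open import Data.Rational using (ℚ; 0ℚ; _+_; _*_; _/_; _≤_)
open import Data.Product using (Σ; _×_; ∃; ∃-syntax)
open import Data.Sum using (_⊎_)
open import Relation.Nullary using (¬_)
open import Relation.Nullary.Decidable using (⌊_⌋)
open import Relation.Binary.PropositionalEquality using (_≡_)

record Graph (n : ℕ) : Set where
  field
    adj   : Fin n → Fin n → Bool
    sym   : ∀ u v → adj u v ≡ adj v u
    irrefl : ∀ v → adj v v ≡ false
open Graph public

data Walk {n : ℕ} (G : Graph n) : Fin n → Fin n → Set where
  here : ∀ {v} → Walk G v v
  step : ∀ {u w v} → adj G u w ≡ true → Walk G w v → Walk G u v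

-- Connected: nonempty vertex set and every two vertices joined by a walk.
Connected : ∀ {n} → Graph n → Set
Connected {n} G = Fin n × (∀ u v → Walk G u v)

ΣFin : ∀ m → (Fin m → ℚ) → ℚ
ΣFin m f = foldr (λ i acc → f i + acc) 0ℚ (allFin m)

-- 1/m as a rational, with the convention 1/0 := 0 (only used for deg 0,
-- which in a connected graph happens only when n = 1).
inv : ℕ → ℚ
inv zero = 0ℚ
inv (suc m) = + 1 / suc m

deg : ∀ {n} → Graph n → Fin n → ℕ
deg {n} G u = length (filter (λ w → adj G u w Data.Bool.≟ true) (allFin n))
  where import Data.Bool

Config : ℕ → ℕ → Set
Config n k = Fin k → Fin n

occupied : ∀ {n k} → Config n k → Fin n → Bool
occupied {n} {k} c v = any (λ i → ⌊ c i ≟ v ⌋) (allFin k)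

-- A (deterministic) cop strategy: at time t the configuration after the
-- cops' move of round t (time 0 = initial positions). Each cop moves along an
-- edge or stays.
record Strategy {n : ℕ} (G : Graph n) (k : ℕ) : Set where
  field
    pos   : ℕ → Config n k
    legal : ∀ t (i : Fin k) →
            (pos (suc t) i ≡ pos t i) ⊎ (adj G (pos t i) (pos (suc t) i) ≡ true)
open Strategy public

notOcc : Bool → ℚ
notOcc true  = 0ℚ
notOcc false = + 1 / 1

-- survival t v = probability that the robber has not been captured by the
-- end of round t (cops' move then robber's move) and is at vertex v.
-- Round 0 consists only of the initial placement (robber uniform on V).
-- In round t+1: cops move to pos (t+1) (capture if a cop lands on the robber),
-- then the robber moves to a uniform random neighbour (capture if he lands on a cop).
survival : ∀ {n k} (G : Graph n) → Strategy G k → ℕ → Fin n → ℚ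
survival {n} G σ zero v = notOcc (occupied (pos σ 0) v) * inv n
survival {n} G σ (suc t) v =
  notOcc (occupied (pos σ (suc t)) v) *
  ΣFin n (λ u → (if adj G u v then notOcc (occupied (pos σ (suc t)) u) else 0ℚ)
                * (survival G σ t u * inv (deg G u)))

tail : ∀ {n k} (G : Graph n) → Strategy G k → ℕ → ℚ
tail {n} G σ t = ΣFin n (survival G σ t)

partialExp : ∀ {n k} (G : Graph n) → Strategy G k → ℕ → ℚ
partialExp G σ zero = 0ℚ
partialExp G σ (suc t) = partialExp G σ t + tail G σ t

-- E[T] = Σ_{t ≥ 0} P(T > t) is finite iff these partial sums are bounded.
FiniteExpectedCapture : ∀ {n k} (G : Graph n) → Strategy G k → Set
FiniteExpectedCapture G σ = ∃[ B ] ∀ t → partialExp G σ t ≤ B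

idctFinite : ∀ {n} → Graph n → ℕ → Set
idctFinite G k = ∃[ σ ] FiniteExpectedCapture {k = k} G σ

-- Let every cop sit on one vertex c forever. From each vertex u there is a
-- walk to c of length at most W, and the robber follows it with probability
-- at least n^(-W), unless he is caught earlier. So within
-- every window of W rounds a fixed fraction of the surviving probability mass
-- is captured: P(T > t + W) ≤ (1 - n^(-W-1)) P(T > t). Such geometric decay of
-- the tail makes E[T] = Σ_t P(T > t) finite.
module Submission where

open import Defs hiding (sym)
open import Data.Nat using (ℕ; zero; suc; _≥_)
import Data.Nat as ℕ
import Data.Nat.Properties as ℕₚ
import Data.Nat.Coprimality as Coprime
import Data.Integer as ℤ
import Data.Integer.Properties as ℤₚ
open import Data.Fin using (Fin)
import Data.Fin as Fin
open import Data.Bool using (Bool; true; false; if_then_else_)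
import Data.Bool as Bool
open import Data.List using (List; []; _∷_; foldr; filter; length; map; allFin)
import Data.List.Properties as Listₚ
open import Data.List.Relation.Unary.Any using (here; there)
import Data.List.Relation.Unary.Any as Any
open import Data.List.Membership.Propositional using (_∈_)
open import Data.List.Membership.Propositional.Properties using (∈-allFin; ∈-filter⁺; ∈-map⁺)
open import Data.List.Extrema.Nat using (max; v≤max⁺)
open import Data.Rational using (ℚ; mkℚ; 0ℚ; 1ℚ; _+_; _*_; -_; _≤_; 1/_; nonNegative; *≤*)
open import Data.Rational.Properties
import Data.Rational.Unnormalised as ℚᵘ
import Data.Rational.Unnormalised.Properties as ℚᵘₚ
open import Data.Rational.Solver using (module +-*-Solver)
open import Algebra.Bundles using (CommutativeRing)
open import Algebra.Properties.CommutativeSemiring.Exp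
  (CommutativeRing.commutativeSemiring +-*-commutativeRing) using (_^_; ^-distrib-*)
open import Data.Product using (_,_)
open import Data.Sum using (inj₁; inj₂)
open import Relation.Nullary using (yes; no; contradiction)
open import Relation.Binary.PropositionalEquality

open +-*-Solver
open ≤-Reasoning

private
  variable
    p q r x : ℚ
    m m′ : ℕ

0≤1 : 0ℚ ≤ 1ℚ
0≤1 = nonNegative⁻¹ 1ℚ

+-nonNeg : 0ℚ ≤ p → 0ℚ ≤ q → 0ℚ ≤ p + q
+-nonNeg {p} {q} 0≤p 0≤q = subst (_≤ p + q) (+-identityʳ 0ℚ) (+-mono-≤ 0≤p 0≤q)

*-monoˡ-≤′ : 0ℚ ≤ r → p ≤ q → r * p ≤ r * q
*-monoˡ-≤′ {r} 0≤r = *-monoˡ-≤-nonNeg r {{nonNegative 0≤r}}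

*-monoʳ-≤′ : 0ℚ ≤ r → p ≤ q → p * r ≤ q * r
*-monoʳ-≤′ {r} 0≤r = *-monoʳ-≤-nonNeg r {{nonNegative 0≤r}}

*-nonNeg : 0ℚ ≤ p → 0ℚ ≤ q → 0ℚ ≤ p * q
*-nonNeg {p} 0≤p 0≤q = subst (_≤ p * _) (*-zeroʳ p) (*-monoˡ-≤′ 0≤p 0≤q)

*-≤-of-≤1 : 0ℚ ≤ q → p ≤ 1ℚ → p * q ≤ q
*-≤-of-≤1 {q} {p} 0≤q p≤1 = subst (p * q ≤_) (*-identityˡ q) (*-monoʳ-≤′ 0≤q p≤1)

p≤p+q : 0ℚ ≤ q → p ≤ p + q
p≤p+q {q} {p} 0≤q = subst (_≤ p + q) (+-identityʳ p) (+-monoʳ-≤ p 0≤q)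

p≤q+p : 0ℚ ≤ q → p ≤ q + p
p≤q+p {q} {p} 0≤q = subst (_≤ q + p) (+-identityˡ p) (+-monoˡ-≤ p 0≤q)

+-cancelʳ-≤ : ∀ r → p + r ≤ q + r → p ≤ q
+-cancelʳ-≤ r p+r≤q+r = subst₂ _≤_ (cancel _) (cancel _) (+-monoˡ-≤ (- r) p+r≤q+r)
  where
  cancel : ∀ x → x + r + - r ≡ x
  cancel x = trans (+-assoc x r (- r)) (trans (cong (x +_) (+-inverseʳ r)) (+-identityʳ x))

toℚ : ℕ → ℚ
toℚ m = mkℚ (ℤ.+ m) 0 (Coprime.sym (Coprime.1-coprimeTo m))

toℚ-nonNeg : ∀ m → 0ℚ ≤ toℚ m
toℚ-nonNeg m = nonNegative⁻¹ (toℚ m)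

toℚ-suc : ∀ m → toℚ (suc m) ≡ 1ℚ + toℚ m
toℚ-suc m = toℚᵘ-injective (ℚᵘₚ.≃-trans (ℚᵘ.*≡* numerators) (ℚᵘₚ.≃-sym (toℚᵘ-homo-+ 1ℚ (toℚ m))))
  where
  numerators : ℤ.+ suc m ℤ.* ℤ.+ 1 ≡ (ℤ.+ 1 ℤ.* ℤ.+ 1 ℤ.+ ℤ.+ m ℤ.* ℤ.+ 1) ℤ.* ℤ.+ 1
  numerators rewrite ℤₚ.*-identityʳ (ℤ.+ suc m)
                   | ℤₚ.*-identityʳ (ℤ.+ 1 ℤ.* ℤ.+ 1 ℤ.+ ℤ.+ m ℤ.* ℤ.+ 1)
                   | ℤₚ.*-identityʳ (ℤ.+ m) = refl

inv-suc : ∀ m → inv (suc m) ≡ 1/ toℚ (suc m)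
inv-suc m = normalize-coprime (Coprime.1-coprimeTo (suc m))

inv*toℚ : ∀ m → inv (suc m) * toℚ (suc m) ≡ 1ℚ
inv*toℚ m = trans (cong (_* toℚ (suc m)) (inv-suc m)) (*-inverseˡ (toℚ (suc m)))

inv-nonNeg : ∀ m → 0ℚ ≤ inv m
inv-nonNeg zero = ≤-refl
inv-nonNeg (suc m) rewrite inv-suc m = nonNegative⁻¹ (1/ toℚ (suc m))

inv-antimono : 1 ℕ.≤ m → m ℕ.≤ m′ → inv m′ ≤ inv m
inv-antimono {suc m} {suc m′} _ m≤m′ rewrite inv-suc m | inv-suc m′ =
  *≤* (subst₂ ℤ._≤_ (sym (ℤₚ.*-identityˡ _)) (sym (ℤₚ.*-identityˡ _)) (ℤ.+≤+ m≤m′))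

inv-≤1 : ∀ m → inv m ≤ 1ℚ
inv-≤1 zero = 0≤1
inv-≤1 (suc m) = inv-antimono {1} {suc m} (ℕ.s≤s ℕ.z≤n) (ℕ.s≤s ℕ.z≤n)

-- inv 0 = 0 makes this hold for m = 0 as well.
*inv*toℚ-≤ : ∀ m → 0ℚ ≤ x → x * inv m * toℚ m ≤ x
*inv*toℚ-≤ {x} zero 0≤x = subst (_≤ x) (sym (trans (cong (_* toℚ 0) (*-zeroʳ x)) (*-zeroˡ (toℚ 0)))) 0≤x
*inv*toℚ-≤ {x} (suc m) _ =
  ≤-reflexive (trans (*-assoc x _ _) (trans (cong (x *_) (inv*toℚ m)) (*-identityʳ x)))

^-nonNeg : ∀ m → 0ℚ ≤ p → 0ℚ ≤ p ^ m
^-nonNeg zero _ = 0≤1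
^-nonNeg (suc m) 0≤p = *-nonNeg 0≤p (^-nonNeg m 0≤p)

^-≤1 : ∀ m → 0ℚ ≤ p → p ≤ 1ℚ → p ^ m ≤ 1ℚ
^-≤1 zero _ _ = ≤-refl
^-≤1 (suc m) 0≤p p≤1 = ≤-trans (*-≤-of-≤1 (^-nonNeg m 0≤p) p≤1) (^-≤1 m 0≤p p≤1)

^-antimono : 0ℚ ≤ p → p ≤ 1ℚ → m ℕ.≤ m′ → p ^ m′ ≤ p ^ m
^-antimono {m′ = m′} 0≤p p≤1 ℕ.z≤n = ^-≤1 m′ 0≤p p≤1
^-antimono 0≤p p≤1 (ℕ.s≤s m≤m′) = *-monoˡ-≤′ 0≤p (^-antimono 0≤p p≤1 m≤m′)

1^ : ∀ m → 1ℚ ^ m ≡ 1ℚ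
1^ zero = refl
1^ (suc m) = trans (*-identityˡ _) (1^ m)

-- ΣFin m f is ∑ (allFin m) f by definition; arbitrary lists make induction possible.
∑ : {A : Set} → List A → (A → ℚ) → ℚ
∑ xs f = foldr (λ x acc → f x + acc) 0ℚ xs

module _ {A : Set} where

  ∑-cong : ∀ (xs : List A) {f g : A → ℚ} → (∀ x → f x ≡ g x) → ∑ xs f ≡ ∑ xs g
  ∑-cong [] _ = refl
  ∑-cong (x ∷ xs) f≡g = cong₂ _+_ (f≡g x) (∑-cong xs f≡g)

  ∑-mono : ∀ (xs : List A) {f g : A → ℚ} → (∀ x → f x ≤ g x) → ∑ xs f ≤ ∑ xs g
  ∑-mono [] _ = ≤-refl
  ∑-mono (x ∷ xs) f≤g = +-mono-≤ (f≤g x) (∑-mono xs f≤g)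

  ∑-nonNeg : ∀ (xs : List A) {f : A → ℚ} → (∀ x → 0ℚ ≤ f x) → 0ℚ ≤ ∑ xs f
  ∑-nonNeg [] _ = ≤-refl
  ∑-nonNeg (x ∷ xs) 0≤f = +-nonNeg (0≤f x) (∑-nonNeg xs 0≤f)

  ∑-zero : ∀ (xs : List A) → ∑ xs (λ _ → 0ℚ) ≡ 0ℚ
  ∑-zero [] = refl
  ∑-zero (x ∷ xs) = trans (+-identityˡ _) (∑-zero xs)

  ∑-+ : ∀ (xs : List A) (f g : A → ℚ) → ∑ xs (λ x → f x + g x) ≡ ∑ xs f + ∑ xs g
  ∑-+ [] f g = sym (+-identityˡ 0ℚ)
  ∑-+ (x ∷ xs) f g = trans (cong (f x + g x +_) (∑-+ xs f g))
    (solve 4 (λ a b c d → (a :+ b) :+ (c :+ d) := (a :+ c) :+ (b :+ d)) refl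
           (f x) (g x) (∑ xs f) (∑ xs g))

  ∑-*ˡ : ∀ (xs : List A) c (f : A → ℚ) → ∑ xs (λ x → c * f x) ≡ c * ∑ xs f
  ∑-*ˡ [] c f = sym (*-zeroʳ c)
  ∑-*ˡ (x ∷ xs) c f = trans (cong (c * f x +_) (∑-*ˡ xs c f)) (sym (*-distribˡ-+ c (f x) (∑ xs f)))

  ∑-const : ∀ (xs : List A) c → ∑ xs (λ _ → c) ≡ c * toℚ (length xs)
  ∑-const [] c = sym (*-zeroʳ c)
  ∑-const (x ∷ xs) c = begin-equality
    c + ∑ xs (λ _ → c)         ≡⟨ cong (c +_) (∑-const xs c) ⟩
    c + c * toℚ (length xs)    ≡⟨ solve 2 (λ c l → c :+ c :* l := c :* (con 1ℚ :+ l)) refl c _ ⟩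
    c * (1ℚ + toℚ (length xs)) ≡⟨ cong (c *_) (toℚ-suc (length xs)) ⟨
    c * toℚ (suc (length xs))  ∎

  term-≤-∑ : ∀ (xs : List A) {f : A → ℚ} {x} → x ∈ xs → (∀ y → 0ℚ ≤ f y) → f x ≤ ∑ xs f
  term-≤-∑ (y ∷ xs) (here refl) 0≤f = p≤p+q (∑-nonNeg xs 0≤f)
  term-≤-∑ (y ∷ xs) (there x∈xs) 0≤f = ≤-trans (term-≤-∑ xs x∈xs 0≤f) (p≤q+p (0≤f y))

  ∑-mono-gap : ∀ (xs : List A) {f g : A → ℚ} {x} {d} → x ∈ xs →
               (∀ y → f y ≤ g y) → f x + d ≤ g x → ∑ xs f + d ≤ ∑ xs g
  ∑-mono-gap (y ∷ xs) {f} {d = d} (here refl) f≤g gap =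
    subst (_≤ _) (solve 3 (λ a b c → (a :+ c) :+ b := (a :+ b) :+ c) refl (f y) (∑ xs f) d)
          (+-mono-≤ gap (∑-mono xs f≤g))
  ∑-mono-gap (y ∷ xs) {f} {d = d} (there x∈xs) f≤g gap =
    subst (_≤ _) (sym (+-assoc (f y) (∑ xs f) d)) (+-mono-≤ (f≤g y) (∑-mono-gap xs x∈xs f≤g gap))

∑-comm : ∀ {A B : Set} (xs : List A) (ys : List B) (f : A → B → ℚ) →
         ∑ xs (λ x → ∑ ys (f x)) ≡ ∑ ys (λ y → ∑ xs (λ x → f x y))
∑-comm [] ys f = sym (∑-zero ys)
∑-comm (x ∷ xs) ys f = trans (cong (∑ ys (f x) +_) (∑-comm xs ys f))
  (sym (∑-+ ys (f x) (λ y → ∑ xs (λ x′ → f x′ y))))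

∑-allFin-const : ∀ m c → ∑ (allFin m) (λ _ → c) ≡ toℚ m * c
∑-allFin-const m c = trans (∑-const (allFin m) c)
  (trans (cong (λ l → c * toℚ l) (Listₚ.length-tabulate (λ i → i))) (*-comm c (toℚ m)))

𝟙 : Bool → ℚ
𝟙 true = 1ℚ
𝟙 false = 0ℚ

𝟙-nonNeg : ∀ b → 0ℚ ≤ 𝟙 b
𝟙-nonNeg true = 0≤1
𝟙-nonNeg false = ≤-refl

∑-𝟙 : ∀ {A : Set} (xs : List A) (P : A → Bool) →
      ∑ xs (λ x → 𝟙 (P x)) ≡ toℚ (length (filter (λ x → P x Bool.≟ true) xs))
∑-𝟙 [] P = refl
∑-𝟙 (x ∷ xs) P with P x
... | true = trans (cong (1ℚ +_) (∑-𝟙 xs P)) (sym (toℚ-suc _))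
... | false = trans (+-identityˡ _) (∑-𝟙 xs P)

∑< : (ℕ → ℚ) → ℕ → ℚ
∑< f zero = 0ℚ
∑< f (suc t) = ∑< f t + f t

partialExp≡∑<tail : ∀ {n k} (G : Graph n) (σ : Strategy G k) t → partialExp G σ t ≡ ∑< (tail G σ) t
partialExp≡∑<tail G σ zero = refl
partialExp≡∑<tail G σ (suc t) = cong (_+ tail G σ t) (partialExp≡∑<tail G σ t)

module _ {f : ℕ → ℚ} where

  antitone-+ : (∀ t → f (suc t) ≤ f t) → ∀ j t → f (j ℕ.+ t) ≤ f t
  antitone-+ f-antitone zero t = ≤-refl
  antitone-+ f-antitone (suc j) t = ≤-trans (f-antitone (j ℕ.+ t)) (antitone-+ f-antitone j t)

  antitone-≤ : (∀ t → f (suc t) ≤ f t) → ∀ {t t′} → t ℕ.≤ t′ → f t′ ≤ f t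
  antitone-≤ f-antitone {t} {t′} t≤t′ =
    subst (λ t″ → f t″ ≤ f t) (ℕₚ.m∸n+n≡m t≤t′) (antitone-+ f-antitone (t′ ℕ.∸ t) t)

  ∑<-mono : (∀ t → 0ℚ ≤ f t) → ∀ {t t′} → t ℕ.≤ t′ → ∑< f t ≤ ∑< f t′
  ∑<-mono f-nonNeg {t} {t′} t≤t′ = subst (λ t″ → ∑< f t ≤ ∑< f t″) (ℕₚ.m∸n+n≡m t≤t′) (grow (t′ ℕ.∸ t))
    where
    grow : ∀ j → ∑< f t ≤ ∑< f (j ℕ.+ t)
    grow zero = ≤-refl
    grow (suc j) = ≤-trans (grow j) (p≤p+q (f-nonNeg (j ℕ.+ t)))

  ∑<-+ : (∀ t → f (suc t) ≤ f t) → ∀ j t → ∑< f (j ℕ.+ t) ≤ ∑< f t + toℚ j * f t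
  ∑<-+ f-antitone zero t = ≤-reflexive (sym (trans (cong (∑< f t +_) (*-zeroˡ (f t))) (+-identityʳ _)))
  ∑<-+ f-antitone (suc j) t = begin
    ∑< f (j ℕ.+ t) + f (j ℕ.+ t)  ≤⟨ +-mono-≤ (∑<-+ f-antitone j t) (antitone-+ f-antitone j t) ⟩
    ∑< f t + toℚ j * f t + f t    ≡⟨ solve 3 (λ s j x → s :+ j :* x :+ x := s :+ (con 1ℚ :+ j) :* x)
                                           refl (∑< f t) (toℚ j) (f t) ⟩
    ∑< f t + (1ℚ + toℚ j) * f t   ≡⟨ cong (λ y → ∑< f t + y * f t) (toℚ-suc j) ⟨
    ∑< f t + toℚ (suc j) * f t    ∎

  -- The hypothesis says f (t + W) ≤ (1 - 1/a) f t; the potential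
  -- ∑< f t + a W f t does not increase over windows of length W.
  ∑<-bounded : (∀ t → 0ℚ ≤ f t) → (∀ t → f (suc t) ≤ f t) →
               ∀ w a → 0ℚ ≤ a → (∀ t → a * f (suc w ℕ.+ t) + f t ≤ a * f t) →
               ∀ t → ∑< f t ≤ a * toℚ (suc w) * f 0
  ∑<-bounded f-nonNeg f-antitone w a 0≤a contraction t = begin
    ∑< f t           ≤⟨ ∑<-mono f-nonNeg (ℕₚ.m≤m*n t W) ⟩
    ∑< f (t ℕ.* W)   ≤⟨ p≤p+q (*-nonNeg (*-nonNeg 0≤a (toℚ-nonNeg W)) (f-nonNeg _)) ⟩
    Φ (t ℕ.* W)      ≤⟨ Φ-multiple t ⟩
    Φ 0              ≡⟨ +-identityˡ _ ⟩
    K * f 0          ∎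
    where
    W : ℕ
    W = suc w
    K : ℚ
    K = a * toℚ W

    Φ : ℕ → ℚ
    Φ t = ∑< f t + K * f t

    Φ-step : ∀ t → Φ (W ℕ.+ t) ≤ Φ t
    Φ-step t = +-cancelʳ-≤ (toℚ W * f t) (begin
      Φ (W ℕ.+ t) + toℚ W * f t
        ≡⟨ solve 5 (λ s′ x′ x a w → s′ :+ (a :* w) :* x′ :+ w :* x := s′ :+ w :* (a :* x′ :+ x))
                 refl (∑< f (W ℕ.+ t)) (f (W ℕ.+ t)) (f t) a (toℚ W) ⟩
      ∑< f (W ℕ.+ t) + toℚ W * (a * f (W ℕ.+ t) + f t)
        ≤⟨ +-mono-≤ (∑<-+ f-antitone W t) (*-monoˡ-≤′ (toℚ-nonNeg W) (contraction t)) ⟩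
      ∑< f t + toℚ W * f t + toℚ W * (a * f t)
        ≡⟨ solve 4 (λ s x a w → s :+ w :* x :+ w :* (a :* x) := s :+ (a :* w) :* x :+ w :* x)
                 refl (∑< f t) (f t) a (toℚ W) ⟩
      Φ t + toℚ W * f t ∎)

    Φ-multiple : ∀ m → Φ (m ℕ.* W) ≤ Φ 0
    Φ-multiple zero = ≤-refl
    Φ-multiple (suc m) = ≤-trans (Φ-step (m ℕ.* W)) (Φ-multiple m)

module _ {n : ℕ} (G : Graph n) where

  walkLength : ∀ {u v} → Walk G u v → ℕ
  walkLength here = 0
  walkLength (step _ p) = suc (walkLength p)

  deg-≤ : ∀ u → deg G u ℕ.≤ n
  deg-≤ u = ℕₚ.≤-trans (Listₚ.length-filter (λ w → adj G u w Bool.≟ true) (allFin n))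
                       (ℕₚ.≤-reflexive (Listₚ.length-tabulate (λ v → v)))

  deg-pos : ∀ {u w} → adj G u w ≡ true → 1 ℕ.≤ deg G u
  deg-pos {u} {w} u~w = nonEmpty (∈-filter⁺ (λ v → adj G u v Bool.≟ true) (∈-allFin w) u~w)
    where
    nonEmpty : ∀ {xs : List (Fin n)} → w ∈ xs → 1 ℕ.≤ length xs
    nonEmpty (here _) = ℕ.s≤s ℕ.z≤n
    nonEmpty (there _) = ℕ.s≤s ℕ.z≤n

  inv-≤-inv-deg : ∀ {u w} → adj G u w ≡ true → inv n ≤ inv (deg G u)
  inv-≤-inv-deg u~w = inv-antimono (deg-pos u~w) (deg-≤ _)

occupied-head : ∀ {n k} (cops : Config n (suc k)) → occupied cops (cops Fin.zero) ≡ true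
occupied-head cops with cops Fin.zero Fin.≟ cops Fin.zero
... | yes _ = refl
... | no c≢c = contradiction refl c≢c

notOcc-nonNeg : ∀ b → 0ℚ ≤ notOcc b
notOcc-nonNeg true = ≤-refl
notOcc-nonNeg false = 0≤1

notOcc-≤1 : ∀ b → notOcc b ≤ 1ℚ
notOcc-≤1 true = 0≤1
notOcc-≤1 false = ≤-refl

notOcc-idem : ∀ b x → notOcc b * (notOcc b * x) ≡ notOcc b * x
notOcc-idem true x = trans (*-zeroˡ (0ℚ * x)) (sym (*-zeroˡ x))
notOcc-idem false x = *-identityˡ _

module StationaryCops {n k : ℕ} (G : Graph n) (cops : Config n k) where

  stay : Strategy G k
  stay = record { pos = λ _ → cops ; legal = λ _ _ → inj₁ refl }

  s : ℕ → Fin n → ℚ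
  s = survival G stay

  T : ℕ → ℚ
  T = tail G stay

  free : Fin n → ℚ
  free v = notOcc (occupied cops v)

  pass : Fin n → Fin n → ℚ
  pass u v = if adj G u v then free u else 0ℚ

  out : ℕ → Fin n → ℚ
  out t u = s t u * inv (deg G u)

  s-suc : ∀ t v → s (suc t) v ≡ free v * ∑ (allFin n) (λ u → pass u v * out t u)
  s-suc t v = refl

  freeNeighbours : Fin n → ℚ
  freeNeighbours u = ∑ (allFin n) (λ v → free v * 𝟙 (adj G u v))

  pass-nonNeg : ∀ u v → 0ℚ ≤ pass u v
  pass-nonNeg u v with adj G u v
  ... | true = notOcc-nonNeg (occupied cops u)
  ... | false = ≤-refl

  pass-≤-adj : ∀ u v → pass u v ≤ 𝟙 (adj G u v)
  pass-≤-adj u v with adj G u v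
  ... | true = notOcc-≤1 (occupied cops u)
  ... | false = ≤-refl

  s-nonNeg : ∀ t v → 0ℚ ≤ s t v
  s-nonNeg zero v = *-nonNeg (notOcc-nonNeg (occupied cops v)) (inv-nonNeg n)
  s-nonNeg (suc t) v = *-nonNeg (notOcc-nonNeg (occupied cops v))
    (∑-nonNeg (allFin n) λ u → *-nonNeg (pass-nonNeg u v) (*-nonNeg (s-nonNeg t u) (inv-nonNeg (deg G u))))

  out-nonNeg : ∀ t u → 0ℚ ≤ out t u
  out-nonNeg t u = *-nonNeg (s-nonNeg t u) (inv-nonNeg (deg G u))

  T-nonNeg : ∀ t → 0ℚ ≤ T t
  T-nonNeg t = ∑-nonNeg (allFin n) (s-nonNeg t)

  free-s : ∀ t v → free v * s t v ≡ s t v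
  free-s zero v = notOcc-idem (occupied cops v) _
  free-s (suc t) v = notOcc-idem (occupied cops v) _

  s-occupied : ∀ {v} → occupied cops v ≡ true → ∀ t → s t v ≡ 0ℚ
  s-occupied occ zero rewrite occ = *-zeroˡ (inv n)
  s-occupied {v} occ (suc t) rewrite occ = *-zeroˡ (∑ (allFin n) (λ u → pass u v * out t u))

  s-spread : ∀ t {u w} → adj G u w ≡ true → occupied cops w ≡ false → out t u ≤ s (suc t) w
  s-spread t {u} {w} u~w w-free = begin
    out t u                                        ≡⟨ pass-out ⟨
    pass u w * out t u                             ≤⟨ term-≤-∑ (allFin n) (∈-allFin u)
                                                       (λ u′ → *-nonNeg (pass-nonNeg u′ w) (out-nonNeg t u′)) ⟩
    ∑ (allFin n) (λ u′ → pass u′ w * out t u′)     ≡⟨ *-identityˡ _ ⟨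
    1ℚ * ∑ (allFin n) (λ u′ → pass u′ w * out t u′) ≡⟨ cong (λ b → notOcc b * ∑ (allFin n) (λ u′ → pass u′ w * out t u′)) w-free ⟨
    free w * ∑ (allFin n) (λ u′ → pass u′ w * out t u′) ≡⟨ s-suc t w ⟨
    s (suc t) w                                    ∎
    where
    pass-out : pass u w * out t u ≡ out t u
    pass-out rewrite u~w = trans (sym (*-assoc (free u) (s t u) _)) (cong (_* inv (deg G u)) (free-s t u))

  freeNeighbours-≤-deg : ∀ u → freeNeighbours u ≤ toℚ (deg G u)
  freeNeighbours-≤-deg u = begin
    freeNeighbours u                     ≤⟨ ∑-mono (allFin n) (λ v → *-≤-of-≤1 (𝟙-nonNeg (adj G u v)) (notOcc-≤1 (occupied cops v))) ⟩
    ∑ (allFin n) (λ v → 𝟙 (adj G u v))   ≡⟨ ∑-𝟙 (allFin n) (adj G u) ⟩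
    toℚ (deg G u)                        ∎

  freeNeighbours-<-deg : ∀ {u w} → adj G u w ≡ true → occupied cops w ≡ true →
                         freeNeighbours u + 1ℚ ≤ toℚ (deg G u)
  freeNeighbours-<-deg {u} {w} u~w w-occ = begin
    freeNeighbours u + 1ℚ                ≤⟨ ∑-mono-gap (allFin n) (∈-allFin w)
                                              (λ v → *-≤-of-≤1 (𝟙-nonNeg (adj G u v)) (notOcc-≤1 (occupied cops v))) gap ⟩
    ∑ (allFin n) (λ v → 𝟙 (adj G u v))   ≡⟨ ∑-𝟙 (allFin n) (adj G u) ⟩
    toℚ (deg G u)                        ∎
    where
    gap : free w * 𝟙 (adj G u w) + 1ℚ ≤ 𝟙 (adj G u w)
    gap rewrite u~w | w-occ = ≤-refl

  out*freeNeighbours-≤ : ∀ t u → out t u * freeNeighbours u ≤ s t u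
  out*freeNeighbours-≤ t u = ≤-trans (*-monoˡ-≤′ (out-nonNeg t u) (freeNeighbours-≤-deg u))
                                     (*inv*toℚ-≤ (deg G u) (s-nonNeg t u))

  out*freeNeighbours+out-≤ : ∀ t {u w} → adj G u w ≡ true → occupied cops w ≡ true →
                             out t u * freeNeighbours u + out t u ≤ s t u
  out*freeNeighbours+out-≤ t {u} u~w w-occ = begin
    out t u * freeNeighbours u + out t u  ≡⟨ cong (out t u * freeNeighbours u +_) (*-identityʳ (out t u)) ⟨
    out t u * freeNeighbours u + out t u * 1ℚ ≡⟨ *-distribˡ-+ (out t u) _ 1ℚ ⟨
    out t u * (freeNeighbours u + 1ℚ)     ≤⟨ *-monoˡ-≤′ (out-nonNeg t u) (freeNeighbours-<-deg u~w w-occ) ⟩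
    out t u * toℚ (deg G u)               ≤⟨ *inv*toℚ-≤ (deg G u) (s-nonNeg t u) ⟩
    s t u                                 ∎

  -- Of the mass out t u sent to each neighbour of u, only what reaches a free neighbour survives.
  T-suc-≤ : ∀ t → T (suc t) ≤ ∑ (allFin n) (λ u → out t u * freeNeighbours u)
  T-suc-≤ t = begin
    T (suc t)
      ≡⟨ ∑-cong V (s-suc t) ⟩
    ∑ V (λ v → free v * ∑ V (λ u → pass u v * out t u))
      ≤⟨ ∑-mono V (λ v → *-monoˡ-≤′ (notOcc-nonNeg (occupied cops v))
                          (∑-mono V (λ u → *-monoʳ-≤′ (out-nonNeg t u) (pass-≤-adj u v)))) ⟩
    ∑ V (λ v → free v * ∑ V (λ u → 𝟙 (adj G u v) * out t u))
      ≡⟨ ∑-cong V (λ v → ∑-*ˡ V (free v) (λ u → 𝟙 (adj G u v) * out t u)) ⟨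
    ∑ V (λ v → ∑ V (λ u → free v * (𝟙 (adj G u v) * out t u)))
      ≡⟨ ∑-comm V V (λ v u → free v * (𝟙 (adj G u v) * out t u)) ⟩
    ∑ V (λ u → ∑ V (λ v → free v * (𝟙 (adj G u v) * out t u)))
      ≡⟨ ∑-cong V (λ u → trans (∑-cong V (λ v → rearrange (free v) (𝟙 (adj G u v)) (out t u)))
                               (∑-*ˡ V (out t u) (λ v → free v * 𝟙 (adj G u v)))) ⟩
    ∑ V (λ u → out t u * freeNeighbours u) ∎
    where
    V : List (Fin n)
    V = allFin n
    rearrange : ∀ a b c → a * (b * c) ≡ c * (a * b)
    rearrange = solve 3 (λ a b c → a :* (b :* c) := c :* (a :* b)) refl

  T-suc-drop : ∀ t u {d} → out t u * freeNeighbours u + d ≤ s t u → T (suc t) + d ≤ T t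
  T-suc-drop t u {d} gap = ≤-trans (+-monoˡ-≤ d (T-suc-≤ t))
    (∑-mono-gap (allFin n) (∈-allFin u) (out*freeNeighbours-≤ t) gap)

  T-antitone : ∀ t → T (suc t) ≤ T t
  T-antitone t = ≤-trans (T-suc-≤ t) (∑-mono (allFin n) (out*freeNeighbours-≤ t))

  ρ : ℚ
  ρ = inv n

  ρ-nonNeg : 0ℚ ≤ ρ
  ρ-nonNeg = inv-nonNeg n

  -- Along a walk to an occupied vertex each step keeps at least a fraction ρ
  -- of the mass, until some step is caught.
  T-drop-along-walk : ∀ {u c} → occupied cops c ≡ true → (p : Walk G u c) →
                      ∀ t → T (walkLength G p ℕ.+ t) + s t u * ρ ^ walkLength G p ≤ T t
  T-drop-along-walk {u} c-occ here t = ≤-reflexive (begin-equality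
    T t + s t u * 1ℚ   ≡⟨ cong (λ y → T t + y * 1ℚ) (s-occupied c-occ t) ⟩
    T t + 0ℚ * 1ℚ      ≡⟨ +-identityʳ (T t) ⟩
    T t                ∎)
  T-drop-along-walk {u} c-occ (step {w = w} u~w p) t with occupied cops w in w-occupied
  ... | true = begin
    T (suc L ℕ.+ t) + s t u * ρ ^ suc L  ≤⟨ +-mono-≤ (antitone-≤ T-antitone (ℕ.s≤s (ℕₚ.m≤n+m t L)))
                                                     (*-monoˡ-≤′ (s-nonNeg t u) ρ^suc≤inv) ⟩
    T (suc t) + out t u                  ≤⟨ T-suc-drop t u (out*freeNeighbours+out-≤ t u~w w-occupied) ⟩
    T t                                  ∎
    where
    L : ℕ
    L = walkLength G p
    ρ^suc≤inv : ρ ^ suc L ≤ inv (deg G u)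
    ρ^suc≤inv = ≤-trans (^-antimono {m = 1} {m′ = suc L} ρ-nonNeg (inv-≤1 n) (ℕ.s≤s ℕ.z≤n))
                        (≤-trans (≤-reflexive (*-identityʳ ρ)) (inv-≤-inv-deg G u~w))
  ... | false = begin
    T (suc L ℕ.+ t) + s t u * (ρ * ρ ^ L)  ≡⟨ cong₂ _+_ (cong T (ℕₚ.+-suc L t)) (*-assoc (s t u) ρ (ρ ^ L)) ⟨
    T (L ℕ.+ suc t) + s t u * ρ * ρ ^ L    ≤⟨ +-monoʳ-≤ (T (L ℕ.+ suc t)) (*-monoʳ-≤′ (^-nonNeg L ρ-nonNeg) spread) ⟩
    T (L ℕ.+ suc t) + s (suc t) w * ρ ^ L  ≤⟨ T-drop-along-walk c-occ p (suc t) ⟩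
    T (suc t)                              ≤⟨ T-antitone t ⟩
    T t                                    ∎
    where
    L : ℕ
    L = walkLength G p
    spread : s t u * ρ ≤ s (suc t) w
    spread = ≤-trans (*-monoˡ-≤′ (s-nonNeg t u) (inv-≤-inv-deg G u~w)) (s-spread t u~w w-occupied)

module GuardedVertex {n k : ℕ} (G : Graph (suc n)) (c : Fin (suc n)) (walks : ∀ u → Walk G u c) where

  cops : Config (suc n) (suc k)
  cops _ = c

  open StationaryCops G cops public

  w : ℕ
  w = max 0 (map (λ u → walkLength G (walks u)) (allFin (suc n)))

  W : ℕ
  W = suc w

  walkLength-≤-W : ∀ u → walkLength G (walks u) ℕ.≤ W
  walkLength-≤-W u = ℕₚ.m≤n⇒m≤1+n
    (v≤max⁺ 0 _ (inj₂ (Any.map (λ { refl → ℕₚ.≤-refl }) (∈-map⁺ (λ v → walkLength G (walks v)) (∈-allFin u)))))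

  T-window-drop : ∀ t u → T (W ℕ.+ t) + s t u * ρ ^ W ≤ T t
  T-window-drop t u = begin
    T (W ℕ.+ t) + s t u * ρ ^ W  ≤⟨ +-mono-≤ (antitone-≤ T-antitone (ℕₚ.+-monoˡ-≤ t (walkLength-≤-W u)))
                                             (*-monoˡ-≤′ (s-nonNeg t u) (^-antimono ρ-nonNeg (inv-≤1 (suc n)) (walkLength-≤-W u))) ⟩
    T (L ℕ.+ t) + s t u * ρ ^ L  ≤⟨ T-drop-along-walk (occupied-head cops) (walks u) t ⟩
    T t                          ∎
    where
    L : ℕ
    L = walkLength G (walks u)

  N : ℚ
  N = toℚ (suc n)

  T-window : ∀ t → N * T (W ℕ.+ t) + ρ ^ W * T t ≤ N * T t
  T-window t = begin
    N * T (W ℕ.+ t) + ρ ^ W * T t             ≡⟨ cong₂ _+_ (∑-allFin-const (suc n) (T (W ℕ.+ t)))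
                                                   (trans (∑-cong V (λ u → *-comm (s t u) (ρ ^ W))) (∑-*ˡ V (ρ ^ W) (s t)))  ⟨
    ∑ V (λ _ → T (W ℕ.+ t)) + ∑ V (λ u → s t u * ρ ^ W) ≡⟨ ∑-+ V (λ _ → T (W ℕ.+ t)) (λ u → s t u * ρ ^ W) ⟨
    ∑ V (λ u → T (W ℕ.+ t) + s t u * ρ ^ W)    ≤⟨ ∑-mono V (T-window-drop t) ⟩
    ∑ V (λ _ → T t)                           ≡⟨ ∑-allFin-const (suc n) (T t) ⟩
    N * T t                                   ∎
    where
    V : List (Fin (suc n))
    V = allFin (suc n)

  a : ℚ
  a = N ^ suc W

  N^W*ρ^W : N ^ W * ρ ^ W ≡ 1ℚ
  N^W*ρ^W = begin-equality
    N ^ W * ρ ^ W  ≡⟨ ^-distrib-* N ρ W ⟨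
    (N * ρ) ^ W    ≡⟨ cong (_^ W) (trans (*-comm N ρ) (inv*toℚ n)) ⟩
    1ℚ ^ W         ≡⟨ 1^ W ⟩
    1ℚ             ∎

  T-contraction : ∀ t → a * T (W ℕ.+ t) + T t ≤ a * T t
  T-contraction t = begin
    a * T (W ℕ.+ t) + T t                         ≡⟨ cong (a * T (W ℕ.+ t) +_)
                                                        (trans (cong (_* T t) N^W*ρ^W) (*-identityˡ (T t))) ⟨
    a * T (W ℕ.+ t) + N ^ W * ρ ^ W * T t         ≡⟨ solve 5 (λ N P Q y x → N :* P :* y :+ P :* Q :* x := P :* (N :* y :+ Q :* x))
                                                         refl N (N ^ W) (ρ ^ W) (T (W ℕ.+ t)) (T t) ⟩
    N ^ W * (N * T (W ℕ.+ t) + ρ ^ W * T t)       ≤⟨ *-monoˡ-≤′ (^-nonNeg W (toℚ-nonNeg (suc n))) (T-window t) ⟩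
    N ^ W * (N * T t)                             ≡⟨ solve 3 (λ N P x → P :* (N :* x) := N :* P :* x) refl N (N ^ W) (T t) ⟩
    a * T t                                       ∎

  captureFinite : FiniteExpectedCapture G stay
  captureFinite = a * toℚ W * T 0 , λ t →
    subst (_≤ a * toℚ W * T 0) (sym (partialExp≡∑<tail G stay t))
          (∑<-bounded T-nonNeg T-antitone w a (^-nonNeg (suc W) (toℚ-nonNeg (suc n))) T-contraction t)

theorem6p2 : (n : ℕ) (G : Graph n) → Connected G → (k : ℕ) → k ≥ 1 → idctFinite G k
theorem6p2 zero G (() , _) k _
theorem6p2 (suc n) G _ zero ()
theorem6p2 (suc n) G (c , walks) (suc k) _ = stay , captureFinite
  where open GuardedVertex {k = k} G c (λ u → walks u c)
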